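{- LPO is equivalent to the statement that every bounded, metastable sequence of real numbers converges.
   Context: Work in Bishop-style constructive mathematics: intuitionistic logic with countable and dependent choice; "equivalent" means mutual implication over this base. LPO: for every binary sequence $(a_n)_{n\ge1}$, either $a_n=0$ for all $n$, or there exists $n$ with $a_n=1$. A sequence $(x_n)_{n\ge1}$ in a metric space $(X,d)$ is metastable if for every $\varepsilon>0$ and every function $f:\mathbb{N}\to\mathbb{N}$ there exists $m$ such that $d(x_i,x_j)<\varepsilon$ for all $i,j\in[m,f(m)]$, where $[k,\ell]=\{k,k+1,\dots,\ell\}$. -}

module Defs where

-- Bishop real numbers as regular sequences of rationals, with Bishop's
-- definitions of order, absolute value and difference.

open import Data.Nat as ℕ using (ℕ; zero; suc)
open import Data.Integer using (+_; -[1+_])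
open import Data.Rational using (ℚ; _/_; _+_; _-_; ∣_∣; _≤_; _<_)
open import Data.Product using (Σ; ∃; _×_; _,_)
open import Data.Sum using (_⊎_)
open import Data.Bool using (Bool; true; false)
open import Relation.Binary.PropositionalEquality using (_≡_)

-- 1/(k+1): the k-th index (k ≥ 0) stands for Bishop's index n = k+1.
inv : ℕ → ℚ
inv k = + 1 / suc k

record ℝ : Set where
  constructor mkℝ
  field
    seq : ℕ → ℚ
    reg : ∀ m n → ∣ seq m - seq n ∣ ≤ inv m + inv n
open ℝ public

-- Raw rational sequences (representatives of real-number expressions).
RSeq : Set
RSeq = ℕ → ℚ

cst : ℚ → RSeq
cst q _ = q

-- Bishop: (x - y)_n = x_{2n} - y_{2n}; with 0-based index k (n = k+1),
-- 2n corresponds to index 2k+1.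
_-ᵣ_ : RSeq → RSeq → RSeq
(x -ᵣ y) k = x (suc (k ℕ.+ k)) - y (suc (k ℕ.+ k))

absᵣ : RSeq → RSeq
absᵣ x k = ∣ x k ∣

Pos : RSeq → Set
Pos x = ∃ λ k → inv k < x k

NonNeg : RSeq → Set
NonNeg x = ∀ k → (+ 0 / 1) - inv k ≤ x k

infix 4 _<ℝ_ _≤ℝ_

_<ℝ_ : ℝ → ℝ → Set
x <ℝ y = Pos (seq y -ᵣ seq x)

_≤ℝ_ : ℝ → ℝ → Set
x ≤ℝ y = NonNeg (seq y -ᵣ seq x)

distLt : ℝ → ℝ → ℝ → Set
distLt x y ε = Pos (seq ε -ᵣ absᵣ (seq x -ᵣ seq y))

Positive : ℝ → Set
Positive ε = Pos (seq ε)

AbsLe : ℝ → ℝ → Set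
AbsLe x M = NonNeg (seq M -ᵣ absᵣ (seq x))

LPO : Set
LPO = (a : ℕ → Bool) → (∀ n → a n ≡ false) ⊎ (∃ λ n → a n ≡ true)

-- Sequences of reals (index 0 plays the role of the paper's index 1).
Bounded : (ℕ → ℝ) → Set
Bounded x = ∃ λ (M : ℝ) → ∀ n → AbsLe (x n) M

Metastable : (ℕ → ℝ) → Set
Metastable x = (ε : ℝ) → Positive ε → (f : ℕ → ℕ) →
  ∃ λ m → ∀ i j → m ℕ.≤ i → i ℕ.≤ f m → m ℕ.≤ j → j ℕ.≤ f m →
    distLt (x i) (x j) ε

ConvergesTo : (ℕ → ℝ) → ℝ → Set
ConvergesTo x y = (ε : ℝ) → Positive ε →
  ∃ λ N → ∀ n → N ℕ.≤ n → distLt (x n) y ε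

Converges : (ℕ → ℝ) → Set
Converges x = ∃ λ y → ConvergesTo x y

BoundedMetastableConverge : Set
BoundedMetastableConverge =
  (x : ℕ → ℝ) → Bounded x → Metastable x → Converges x

module Submission where

-- (⇒) Fix a precision K.  For each m, LPO decides whether some later term
-- x_{m+n} is far from x_m (measured at one fixed rational index); let f(m)
-- be such an m+n, or m if there is none.  Metastability applied to f gives
-- an m at which the "far" alternative is impossible, so every term from m
-- on is close to x_m.  Thus LPO turns metastability into a Cauchy modulus,
-- and Bishop reals are complete: a sequence with a Cauchy modulus converges
-- to the diagonal of its representing rational sequences.  If it converges to
-- y, the value of X at any index from which X stays within 1/4 of y
-- decides a.

open import Defs
open import Data.Nat as ℕ using (ℕ; zero; suc)
import Data.Nat.Properties as ℕP
import Data.Nat.Solver as ℕSolver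
open import Data.Integer as ℤ using (+_; -[1+_])
import Data.Integer.Properties as ℤP
open import Data.Nat.Coprimality using (1-coprimeTo)
open import Data.Rational using (ℚ; mkℚ; *<*; toℚᵘ; 0ℚ; _+_; _-_; -_; ∣_∣; _≤_; _<_)
open import Data.Rational.Properties
import Data.Rational.Unnormalised as ℚᵘ
import Data.Rational.Unnormalised.Properties as ℚᵘP
open import Data.Rational.Solver using (module +-*-Solver)
open import Data.Bool using (Bool; true; false; _∨_)
open import Data.Bool.Properties using (∨-zeroʳ)
open import Data.Empty using (⊥; ⊥-elim)
open import Data.Product using (∃; _×_; _,_; proj₁; proj₂)
open import Data.Sum using (_⊎_; inj₁; inj₂)
open import Relation.Nullary using (Dec; yes; no; ¬_; does)
open import Relation.Binary.PropositionalEquality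

open +-*-Solver using (solve; _:=_; _:+_; _:-_; :-_)

-- dbl k is the 0-based index of Bishop's 2n when k stands for n = k+1;
-- it is the index shift used by Defs._-ᵣ_.
dbl : ℕ → ℕ
dbl k = suc (k ℕ.+ k)

-- quad k is the 0-based index of Bishop's 4n.
quad : ℕ → ℕ
quad k = dbl (dbl k)

-- inv k is already in normal form; this lets us compute with its
-- numerator and denominator.
private
  inv-normal : ∀ k → inv k ≡ mkℚ (+ 1) k (1-coprimeTo (suc k))
  inv-normal k = normalize-coprime (1-coprimeTo (suc k))

  toℚᵘ-inv : ∀ k → toℚᵘ (inv k) ≡ ℚᵘ.mkℚᵘ (+ 1) k
  toℚᵘ-inv k rewrite inv-normal k = refl

  one-times : ∀ z → z ≡ + 1 ℤ.* z
  one-times z = sym (ℤP.*-identityˡ z)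

inv-antitone : ∀ {m n} → m ℕ.≤ n → inv n ≤ inv m
inv-antitone {m} {n} m≤n rewrite inv-normal m | inv-normal n =
  toℚᵘ-cancel-≤ (ℚᵘ.*≤* (subst₂ ℤ._≤_ (one-times _) (one-times _) (ℤ.+≤+ (ℕ.s≤s m≤n))))

inv-strictly-antitone : ∀ {m n} → m ℕ.< n → inv n < inv m
inv-strictly-antitone {m} {n} m<n rewrite inv-normal m | inv-normal n =
  toℚᵘ-cancel-< (ℚᵘ.*<* (subst₂ ℤ._<_ (one-times _) (one-times _) (ℤ.+<+ (ℕ.s≤s m<n))))

inv-positive : ∀ k → 0ℚ < inv k
inv-positive k rewrite inv-normal k = toℚᵘ-cancel-< (ℚᵘ.*<* (ℤ.+<+ (ℕ.s≤s ℕ.z≤n)))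

inv-nonneg : ∀ k → 0ℚ ≤ inv k
inv-nonneg k = <⇒≤ (inv-positive k)

-- The cross-multiplied form of inv (dbl k) + inv (dbl k) = inv k.
private
  half-cross : ∀ k → let n = dbl k in
    (+ 1 ℤ.* + suc n ℤ.+ + 1 ℤ.* + suc n) ℤ.* + suc k ≡ + 1 ℤ.* (+ suc n ℤ.* + suc n)
  half-cross k = begin
    (+ 1 ℤ.* + suc n ℤ.+ + 1 ℤ.* + suc n) ℤ.* + suc k ≡⟨ cong (λ z → (z ℤ.+ z) ℤ.* + suc k) (ℤP.*-identityˡ (+ suc n)) ⟩
    + (suc n ℕ.+ suc n) ℤ.* + suc k                   ≡⟨ ℤP.pos-* (suc n ℕ.+ suc n) (suc k) ⟨
    + ((suc n ℕ.+ suc n) ℕ.* suc k)                   ≡⟨ cong +_ cross-ℕ ⟩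
    + (suc n ℕ.* suc n)                               ≡⟨ ℤP.pos-* (suc n) (suc n) ⟩
    + suc n ℤ.* + suc n                               ≡⟨ one-times _ ⟩
    + 1 ℤ.* (+ suc n ℤ.* + suc n)                     ∎
    where
    open ≡-Reasoning
    open ℕSolver.+-*-Solver using () renaming (solve to ℕsolve; _:+_ to _⊕_; _:*_ to _⊗_; _:=_ to _≐_; con to ℕcon)
    n = dbl k
    cross-ℕ : (suc n ℕ.+ suc n) ℕ.* suc k ≡ suc n ℕ.* suc n
    cross-ℕ = ℕsolve 1 (λ k → ((ℕcon 2 ⊕ (k ⊕ k)) ⊕ (ℕcon 2 ⊕ (k ⊕ k))) ⊗ (ℕcon 1 ⊕ k)
                               ≐ (ℕcon 2 ⊕ (k ⊕ k)) ⊗ (ℕcon 2 ⊕ (k ⊕ k))) refl k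

half : ∀ k → inv (dbl k) + inv (dbl k) ≡ inv k
half k = toℚᵘ-injective (begin-equality
    toℚᵘ (inv n + inv n)                       ≃⟨ toℚᵘ-homo-+ (inv n) (inv n) ⟩
    toℚᵘ (inv n) ℚᵘ.+ toℚᵘ (inv n)             ≡⟨ cong₂ ℚᵘ._+_ (toℚᵘ-inv n) (toℚᵘ-inv n) ⟩
    ℚᵘ.mkℚᵘ (+ 1) n ℚᵘ.+ ℚᵘ.mkℚᵘ (+ 1) n       ≃⟨ ℚᵘ.*≡* (half-cross k) ⟩
    ℚᵘ.mkℚᵘ (+ 1) k                            ≡⟨ toℚᵘ-inv k ⟨
    toℚᵘ (inv k)                               ∎)
  where
  open ℚᵘP.≤-Reasoning
  n = dbl k

quarter : ∀ k → (inv (quad k) + inv (quad k)) + (inv (quad k) + inv (quad k)) ≡ inv k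
quarter k = trans (cong₂ _+_ (half (dbl k)) (half (dbl k))) (half k)

archimedean : ∀ d → 0ℚ < d → ∃ λ j → inv j < d
archimedean (mkℚ (+ 0) dm _) (*<* p) =
  ⊥-elim (ℤP.<-irrefl refl (subst₂ ℤ._<_ (ℤP.*-zeroˡ (+ suc dm)) (ℤP.*-zeroˡ (+ 1)) p))
archimedean (mkℚ -[1+ n ] dm _) (*<* p) with subst₂ ℤ._<_ (ℤP.*-zeroˡ (+ suc dm)) (ℤP.*-identityʳ -[1+ n ]) p
... | ()
archimedean d@(mkℚ (+ suc n) dm _) _ =
  suc dm , toℚᵘ-cancel-< (subst (ℚᵘ._< toℚᵘ d) (sym (toℚᵘ-inv (suc dm))) (ℚᵘ.*<* cross))
  where
  cross : + 1 ℤ.* + suc dm ℤ.< + suc n ℤ.* + suc (suc dm)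
  cross = subst₂ ℤ._<_ (one-times _) (ℤP.pos-* (suc n) (suc (suc dm)))
                 (ℤ.+<+ (ℕP.m≤n*m (suc (suc dm)) (suc n)))

p≤∣p∣ : ∀ p → p ≤ ∣ p ∣
p≤∣p∣ p@(mkℚ (+ _) _ _) = ≤-refl
p≤∣p∣ p@(mkℚ -[1+ _ ] _ _) = ≤-trans (<⇒≤ (negative⁻¹ p)) (0≤∣p∣ p)

dist-sym : ∀ a b → ∣ a - b ∣ ≡ ∣ b - a ∣
dist-sym a b = trans (cong ∣_∣ (solve 2 (λ a b → a :- b := :- (b :- a)) refl a b)) (∣-p∣≡∣p∣ (b - a))

dist-triangle : ∀ a b c → ∣ a - c ∣ ≤ ∣ a - b ∣ + ∣ b - c ∣
dist-triangle a b c =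
  subst (λ z → ∣ z ∣ ≤ ∣ a - b ∣ + ∣ b - c ∣) (solve 3 (λ a b c → (a :- b) :+ (b :- c) := a :- c) refl a b c)
        (∣p+q∣≤∣p∣+∣q∣ (a - b) (b - c))

dist-self : ∀ a → ∣ a - a ∣ ≡ 0ℚ
dist-self a = cong ∣_∣ (+-inverseʳ a)

dist-bound : ∀ {a b r} → ∣ a - b ∣ ≤ r → a ≤ r + b
dist-bound {a} {b} {r} p =
  subst (_≤ r + b) (solve 2 (λ a b → (a :- b) :+ b := a) refl a b) (+-monoˡ-≤ b (≤-trans (p≤∣p∣ (a - b)) p))

≤-+-nonneg : ∀ {a b} → 0ℚ ≤ b → a ≤ a + b
≤-+-nonneg {a} {b} p = subst (_≤ a + b) (+-identityʳ a) (+-monoʳ-≤ a p)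

<-sub : ∀ {a b c} → a + c < b → a < b - c
<-sub {a} {b} {c} p = subst (_< b - c) (solve 2 (λ a c → (a :+ c) :- c := a) refl a c) (+-monoˡ-< (- c) p)

sub-< : ∀ {a b c} → a < b - c → a + c < b
sub-< {a} {b} {c} p = subst (a + c <_) (solve 2 (λ b c → (b :- c) :+ c := b) refl b c) (+-monoˡ-< c p)

<⇒0<-difference : ∀ {a b} → a < b → 0ℚ < b - a
<⇒0<-difference {a} {b} p = subst (_< b - a) (+-inverseʳ a) (+-monoˡ-< (- a) p)

+-cancelʳ-< : ∀ {a b c} → a + c < b + c → a < b
+-cancelʳ-< {a} {b} {c} p =
  subst₂ _<_ (solve 2 (λ a c → (a :+ c) :- c := a) refl a c) (solve 2 (λ a c → (a :+ c) :- c := a) refl b c)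
         (+-monoˡ-< (- c) p)

constℝ : ℚ → ℝ
constℝ q = mkℝ (cst q) (λ m n → subst (_≤ inv m + inv n) (sym (dist-self q))
                                      (+-mono-≤ (inv-nonneg m) (inv-nonneg n)))

DistLe : ℝ → ℝ → ℚ → Set
DistLe x y e = ∀ p → ∣ seq x p - seq y p ∣ ≤ e + (inv p + inv p)

-- Regularity transfers a bound at an auxiliary index q to arbitrary indices.
dist-via : (u v : ℝ) (r s q : ℕ) {c : ℚ} → ∣ seq u q - seq v q ∣ ≤ c →
           ∣ seq u r - seq v s ∣ ≤ (inv r + inv q) + (c + (inv q + inv s))
dist-via u v r s q {c} le =
  ≤-trans (dist-triangle (seq u r) (seq u q) (seq v s))
          (+-mono-≤ (reg u r q) (≤-trans (dist-triangle (seq u q) (seq v q) (seq v s)) (+-mono-≤ le (reg v q s))))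

DistLe-at : (x y : ℝ) (P : ℕ) {T : ℚ} → ∣ seq x P - seq y P ∣ ≤ T → DistLe x y (T + (inv P + inv P))
DistLe-at x y P {T} le p =
  subst (∣ seq x p - seq y p ∣ ≤_)
        (solve 3 (λ a b t → (a :+ b) :+ (t :+ (b :+ a)) := (t :+ (b :+ b)) :+ (a :+ a)) refl (inv p) (inv P) T)
        (dist-via x y p p P le)

DistLe-weaken : {x y : ℝ} {e e' : ℚ} → e ≤ e' → DistLe x y e → DistLe x y e'
DistLe-weaken e≤e' d p = ≤-trans (d p) (+-monoˡ-≤ _ e≤e')

DistLe-sym : {x y : ℝ} {e : ℚ} → DistLe x y e → DistLe y x e
DistLe-sym {x} {y} d p = subst (_≤ _) (dist-sym (seq x p) (seq y p)) (d p)

DistLe-refl : (z : ℝ) → DistLe z z 0ℚ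
DistLe-refl z p = subst₂ _≤_ (sym (dist-self (seq z p))) (sym (+-identityˡ _))
                         (+-mono-≤ (inv-nonneg p) (inv-nonneg p))

distLt⇒DistLe : (x y : ℝ) (e : ℚ) → distLt x y (constℝ e) → DistLe x y e
distLt⇒DistLe x y e (j , lt) p = begin
    ∣ seq x p - seq y p ∣                         ≤⟨ dist-via x y p p q ≤-refl ⟩
    (inv p + inv q) + (D + (inv q + inv p))       ≡⟨ solve 3 (λ a b d → (a :+ b) :+ (d :+ (b :+ a)) := (d :+ (b :+ b)) :+ (a :+ a)) refl (inv p) (inv q) D ⟩
    (D + (inv q + inv q)) + (inv p + inv p)       ≡⟨ cong (λ z → (D + z) + (inv p + inv p)) (half (dbl j)) ⟩
    (D + inv (dbl j)) + (inv p + inv p)           ≤⟨ +-monoˡ-≤ _ (+-monoʳ-≤ D (inv-antitone (ℕP.m≤n+m j (suc j)))) ⟩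
    (D + inv j) + (inv p + inv p)                 ≤⟨ +-monoˡ-≤ _ (subst (_≤ e) (+-comm (inv j) D) (<⇒≤ (sub-< lt))) ⟩
    e + (inv p + inv p)                           ∎
  where
  open ≤-Reasoning
  q = quad j
  D = ∣ seq x q - seq y q ∣

DistLe⇒distLt : (x y ε : ℝ) (e : ℚ) (k : ℕ) → e < seq ε k - inv k → DistLe x y e → distLt x y ε
DistLe⇒distLt x y ε e k e<ε d = M , <-sub {b = S} (+-cancelʳ-< estimate)
  where
  open ≤-Reasoning
  -- choose M with 4/(M+1) below the margin ε_k - 1/k - e
  small = archimedean ((seq ε k - inv k) - e) (<⇒0<-difference e<ε)
  j = proj₁ small
  M = quad j
  q = quad M
  S = seq ε (dbl M)
  D = ∣ seq x q - seq y q ∣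
  margin : (e + inv j) + inv k < seq ε k
  margin = subst (λ z → z + inv k < seq ε k) (+-comm (inv j) e)
                 (sub-< (sub-< (proj₂ small)))
  D-bound : D ≤ e + inv M
  D-bound = ≤-trans (d q) (+-monoʳ-≤ e (subst (_≤ inv M) (sym (half (dbl M))) (inv-antitone (ℕP.m≤n+m M (suc M)))))
  estimate : (inv M + D) + (inv k + inv (dbl M)) < S + (inv k + inv (dbl M))
  estimate = begin-strict
    (inv M + D) + (inv k + inv (dbl M))            ≤⟨ +-mono-≤ (+-monoʳ-≤ (inv M) D-bound) (+-monoʳ-≤ (inv k) (inv-antitone (ℕP.m≤n+m M (suc M)))) ⟩
    (inv M + (e + inv M)) + (inv k + inv M)        ≡⟨ solve 4 (λ a e b c → (a :+ (e :+ a)) :+ (b :+ a) := (e :+ ((a :+ a) :+ a)) :+ b) refl (inv M) e (inv k) (inv M) ⟩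
    (e + ((inv M + inv M) + inv M)) + inv k        ≤⟨ +-monoˡ-≤ (inv k) (+-monoʳ-≤ e (≤-+-nonneg (inv-nonneg M))) ⟩
    (e + (((inv M + inv M) + inv M) + inv M)) + inv k ≡⟨ cong (λ z → (e + z) + inv k) (trans (+-assoc (inv M + inv M) (inv M) (inv M)) (quarter j)) ⟩
    (e + inv j) + inv k                            <⟨ margin ⟩
    seq ε k                                        ≤⟨ dist-bound (reg ε k (dbl M)) ⟩
    (inv k + inv (dbl M)) + S                      ≡⟨ +-comm (inv k + inv (dbl M)) S ⟩
    S + (inv k + inv (dbl M))                      ∎

positive-margin : (ε : ℝ) → Positive ε → ∃ λ K → ∀ x y → DistLe x y (inv K) → distLt x y ε
positive-margin ε (k , 1/k<ε) =
  let (K , lt) = archimedean (seq ε k - inv k) (<⇒0<-difference 1/k<ε)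
  in K , λ x y → DistLe⇒distLt x y ε (inv K) k lt

distLt-refl : (z ε : ℝ) → Positive ε → distLt z z ε
distLt-refl z ε ε>0 = let (K , margin) = positive-margin ε ε>0
                      in margin z z (DistLe-weaken {z} {z} (inv-nonneg K) (DistLe-refl z))

constℝ-inv-positive : ∀ k → Positive (constℝ (inv k))
constℝ-inv-positive k = suc k , inv-strictly-antitone (ℕP.n<1+n k)

-- Completeness: a sequence with a Cauchy modulus converges

CauchyModulus : (ℕ → ℝ) → (ℕ → ℕ) → Set
CauchyModulus x N = ∀ K a b → N K ℕ.≤ a → N K ℕ.≤ b → DistLe (x a) (x b) (inv K)

-- Any modulus can be replaced by a larger, monotone one.
runningMax : (ℕ → ℕ) → ℕ → ℕ
runningMax N zero = N zero
runningMax N (suc K) = runningMax N K ℕ.⊔ N (suc K)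

runningMax-≥ : ∀ N K → N K ℕ.≤ runningMax N K
runningMax-≥ N zero = ℕP.≤-refl
runningMax-≥ N (suc K) = ℕP.m≤n⊔m (runningMax N K) (N (suc K))

runningMax-mono : ∀ N {K L} → K ℕ.≤ L → runningMax N K ℕ.≤ runningMax N L
runningMax-mono N {L = zero} ℕ.z≤n = ℕP.≤-refl
runningMax-mono N {L = suc L} K≤1+L with ℕP.m≤n⇒m<n∨m≡n K≤1+L
... | inj₁ K<1+L = ℕP.≤-trans (runningMax-mono N (ℕP.≤-pred K<1+L)) (ℕP.m≤m⊔n (runningMax N L) (N (suc L)))
... | inj₂ refl = ℕP.≤-refl

runningMax-modulus : ∀ x N → CauchyModulus x N → CauchyModulus x (runningMax N)
runningMax-modulus x N cauchy K a b Ma Mb =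
  cauchy K a b (ℕP.≤-trans (runningMax-≥ N K) Ma) (ℕP.≤-trans (runningMax-≥ N K) Mb)

module Limit (x : ℕ → ℝ) (N : ℕ → ℕ) (mono : ∀ {K L} → K ℕ.≤ L → N K ℕ.≤ N L)
             (cauchy : CauchyModulus x N) where

  close : ∀ c d a b → N c ℕ.≤ a → N d ℕ.≤ b → DistLe (x a) (x b) (inv c + inv d)
  close c d a b Nc≤a Nd≤b with ℕP.≤-total c d
  ... | inj₁ c≤d = DistLe-weaken {x a} {x b} {inv c} (≤-+-nonneg (inv-nonneg d))
                     (cauchy c a b Nc≤a (ℕP.≤-trans (mono c≤d) Nd≤b))
  ... | inj₂ d≤c = DistLe-weaken {x a} {x b} {inv d} (subst (inv d ≤_) (+-comm (inv d) (inv c)) (≤-+-nonneg (inv-nonneg c)))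
                     (DistLe-sym {x b} {x a} {inv d} (cauchy d b a Nd≤b (ℕP.≤-trans (mono d≤c) Nc≤a)))

  diagonal-error : ∀ p → let q = dbl (quad p) in
    (inv (quad p) + inv (quad p)) + ((inv q + inv q) + (inv q + inv q)) ≡ inv p
  diagonal-error p = trans (cong (λ z → (inv (quad p) + inv (quad p)) + (z + z)) (half (quad p))) (quarter p)

  limit-seq : ℕ → ℚ
  limit-seq p = seq (x (N (quad p))) (quad p)

  limit-reg : ∀ a b → ∣ limit-seq a - limit-seq b ∣ ≤ inv a + inv b
  limit-reg a b = begin
      ∣ limit-seq a - limit-seq b ∣
        ≤⟨ dist-via (x (N (quad a))) (x (N (quad b))) (quad a) (quad b) q
                    (close (quad a) (quad b) (N (quad a)) (N (quad b)) ℕP.≤-refl ℕP.≤-refl q) ⟩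
      (A + Q) + (((A + B) + (Q + Q)) + (Q + B))
        ≡⟨ solve 3 (λ a b q → (a :+ q) :+ (((a :+ b) :+ (q :+ q)) :+ (q :+ b))
                               := ((a :+ a) :+ ((q :+ q) :+ (q :+ q))) :+ (b :+ b)) refl A B Q ⟩
      ((A + A) + ((Q + Q) + (Q + Q))) + (B + B)
        ≡⟨ cong₂ _+_ (diagonal-error a) (half (dbl b)) ⟩
      inv a + inv (dbl b)
        ≤⟨ +-monoʳ-≤ (inv a) (inv-antitone (ℕP.m≤n+m b (suc b))) ⟩
      inv a + inv b ∎
    where
    open ≤-Reasoning
    q = dbl (quad a)
    A = inv (quad a)
    B = inv (quad b)
    Q = inv q

  limit : ℝ
  limit = mkℝ limit-seq limit-reg

  close-to-limit : ∀ K n → N K ℕ.≤ n → DistLe (x n) limit (inv K)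
  close-to-limit K n NK≤n p = begin
      ∣ seq (x n) p - limit-seq p ∣
        ≤⟨ dist-via (x n) (x (N (quad p))) p (quad p) q (close K (quad p) n (N (quad p)) NK≤n ℕP.≤-refl q) ⟩
      (inv p + Q) + (((inv K + A) + (Q + Q)) + (Q + A))
        ≡⟨ solve 4 (λ r c a q → (r :+ q) :+ (((c :+ a) :+ (q :+ q)) :+ (q :+ a))
                                 := c :+ (r :+ ((a :+ a) :+ ((q :+ q) :+ (q :+ q))))) refl (inv p) (inv K) A Q ⟩
      inv K + (inv p + ((A + A) + ((Q + Q) + (Q + Q))))
        ≡⟨ cong (λ z → inv K + (inv p + z)) (diagonal-error p) ⟩
      inv K + (inv p + inv p) ∎
    where
    open ≤-Reasoning
    q = dbl (quad p)
    A = inv (quad p)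
    Q = inv q

  converges : Converges x
  converges = limit , λ ε ε>0 →
    let (K , margin) = positive-margin ε ε>0
    in N K , λ n NK≤n → margin (x n) limit (close-to-limit K n NK≤n)

cauchy⇒converges : ∀ x N → CauchyModulus x N → Converges x
cauchy⇒converges x N cauchy =
  Limit.converges x (runningMax N) (runningMax-mono N) (runningMax-modulus x N cauchy)

-- LPO turns metastability into a Cauchy modulus

-- The index an LPO decision points to: a position of `true`, or 0.
witness : {g : ℕ → Bool} → (∀ n → g n ≡ false) ⊎ (∃ λ n → g n ≡ true) → ℕ
witness (inj₁ _) = 0
witness (inj₂ (n , _)) = n

witness-spec : {g : ℕ → Bool} (r : (∀ n → g n ≡ false) ⊎ (∃ λ n → g n ≡ true)) →
               (∀ n → g n ≡ false) ⊎ (∃ λ n → g n ≡ true × witness r ≡ n)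
witness-spec (inj₁ none) = inj₁ none
witness-spec (inj₂ (n , gn)) = inj₂ (n , gn , refl)

does-true : {P : Set} (d : Dec P) → does d ≡ true → P
does-true (yes p) _ = p

does-false : {P : Set} (d : Dec P) → does d ≡ false → ¬ P
does-false (no ¬p) _ = ¬p

module _ (lpo : LPO) (x : ℕ → ℝ) (meta : Metastable x) (K : ℕ) where

  private
    -- Closeness is tested at the rational index P with threshold T; the
    -- metastability tolerance is inv (quad K).
    P : ℕ
    P = quad (quad K)

    T : ℚ
    T = inv (quad K) + (inv P + inv P)

    gap : ℕ → ℕ → ℚ
    gap a b = ∣ seq (x a) P - seq (x b) P ∣

    far : ℕ → ℕ → Bool
    far m n = does (T <? gap m (m ℕ.+ n))

    f : ℕ → ℕ
    f m = m ℕ.+ witness (lpo (far m))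

    -- Twice the threshold plus the error of DistLe-at is at most 1/(K+1).
    budget : (T + T) + (inv P + inv P) ≤ inv K
    budget = begin
      (T + T) + (inv P + inv P)                      ≤⟨ +-monoˡ-≤ (inv P + inv P) (+-monoʳ-≤ T (≤-+-nonneg (+-mono-≤ (inv-nonneg P) (inv-nonneg P)))) ⟩
      (T + (T + (inv P + inv P))) + (inv P + inv P)  ≡⟨ solve 2 (λ t r → (t :+ (t :+ r)) :+ r := (t :+ r) :+ (t :+ r)) refl T (inv P + inv P) ⟩
      (T + (inv P + inv P)) + (T + (inv P + inv P))  ≡⟨ cong₂ _+_ T+2/P T+2/P ⟩
      inv (dbl K) + inv (dbl K)                      ≡⟨ half K ⟩
      inv K                                          ∎
      where
      open ≤-Reasoning
      -- with n = K+1: T + 2/P = 1/(4n) + 1/(8n) + 1/(8n) = 1/(2n)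
      2/P : inv P + inv P ≡ inv (dbl (quad K))
      2/P = half (dbl (quad K))
      T+2/P : T + (inv P + inv P) ≡ inv (dbl K)
      T+2/P = begin-equality
        (inv (quad K) + (inv P + inv P)) + (inv P + inv P)   ≡⟨ cong (λ z → (inv (quad K) + z) + z) 2/P ⟩
        (inv (quad K) + inv (dbl (quad K))) + inv (dbl (quad K)) ≡⟨ +-assoc (inv (quad K)) _ _ ⟩
        inv (quad K) + (inv (dbl (quad K)) + inv (dbl (quad K))) ≡⟨ cong (λ z → inv (quad K) + z) (half (quad K)) ⟩
        inv (quad K) + inv (quad K)                          ≡⟨ half (dbl K) ⟩
        inv (dbl K)                                          ∎

    -- If metastability holds at m for f, every term from m on is T-close to
    -- the term m at index P: otherwise LPO found a far term within [m, f m].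
    stable-from : ∀ m → (∀ i j → m ℕ.≤ i → i ℕ.≤ f m → m ℕ.≤ j → j ℕ.≤ f m →
                                 distLt (x i) (x j) (constℝ (inv (quad K)))) →
                  ∀ a → m ℕ.≤ a → gap m a ≤ T
    stable-from m close a m≤a = by-cases (witness-spec (lpo (far m)))
      where
      by-cases : (∀ n → far m n ≡ false) ⊎ (∃ λ n → far m n ≡ true × witness (lpo (far m)) ≡ n) → gap m a ≤ T
      by-cases (inj₁ none-far) =
        subst (λ b → gap m b ≤ T) (ℕP.m+[n∸m]≡n m≤a)
              (≮⇒≥ (does-false (T <? gap m (m ℕ.+ (a ℕ.∸ m))) (none-far (a ℕ.∸ m))))
      by-cases (inj₂ (n , is-far , f-jumps)) =
        ⊥-elim (<-irrefl refl (<-≤-trans (does-true (T <? gap m (m ℕ.+ n)) is-far) near))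
        where
        m+n≤fm : m ℕ.+ n ℕ.≤ f m
        m+n≤fm = ℕP.≤-reflexive (cong (m ℕ.+_) (sym f-jumps))
        near : gap m (m ℕ.+ n) ≤ T
        near = distLt⇒DistLe (x m) (x (m ℕ.+ n)) (inv (quad K))
                 (close m (m ℕ.+ n) ℕP.≤-refl (ℕP.m≤m+n m _) (ℕP.m≤m+n m n) m+n≤fm) P

  lpo-metastable-cauchy : ∃ λ N → ∀ a b → N ℕ.≤ a → N ℕ.≤ b → DistLe (x a) (x b) (inv K)
  lpo-metastable-cauchy = m , λ a b m≤a m≤b →
      DistLe-weaken {x a} {x b} budget (DistLe-at (x a) (x b) P (begin
        gap a b           ≤⟨ dist-triangle (seq (x a) P) (seq (x m) P) (seq (x b) P) ⟩
        gap a m + gap m b ≡⟨ cong (_+ gap m b) (dist-sym (seq (x a) P) (seq (x m) P)) ⟩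
        gap m a + gap m b ≤⟨ +-mono-≤ (stable-from m close a m≤a) (stable-from m close b m≤b) ⟩
        T + T             ∎))
    where
    open ≤-Reasoning
    m = proj₁ (meta (constℝ (inv (quad K))) (constℝ-inv-positive (quad K)) f)
    close = proj₂ (meta (constℝ (inv (quad K))) (constℝ-inv-positive (quad K)) f)

lpo⇒converges : LPO → BoundedMetastableConverge
lpo⇒converges lpo x _ meta =
  cauchy⇒converges x (λ K → proj₁ (lpo-metastable-cauchy lpo x meta K))
                     (λ K → proj₂ (lpo-metastable-cauchy lpo x meta K))

-- Converse: a bounded metastable sequence whose limit decides LPO

seen : (ℕ → Bool) → ℕ → Bool
seen a zero = a zero
seen a (suc n) = seen a n ∨ a (suc n)

seen-witness : ∀ a n → seen a n ≡ true → ∃ λ i → i ℕ.≤ n × a i ≡ true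
seen-witness a zero e = zero , ℕ.z≤n , e
seen-witness a (suc n) e with seen a n in eq
... | true = let (i , i≤n , ai) = seen-witness a n eq in i , ℕP.m≤n⇒m≤1+n i≤n , ai
... | false = suc n , ℕP.≤-refl , e

seen-intro : ∀ a {i} n → i ℕ.≤ n → a i ≡ true → seen a n ≡ true
seen-intro a zero ℕ.z≤n ai = ai
seen-intro a (suc n) i≤1+n ai with ℕP.m≤n⇒m<n∨m≡n i≤1+n
... | inj₁ i<1+n rewrite seen-intro a n (ℕP.≤-pred i<1+n) ai = refl
... | inj₂ refl rewrite ai = ∨-zeroʳ (seen a n)

seen-below : ∀ a {i n} → i ℕ.≤ n → seen a n ≡ false → seen a i ≡ false
seen-below a {i} {n} i≤n not-seen with seen a i in eq
... | false = refl
... | true = let (t , t≤i , at) = seen-witness a i eq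
             in trans (sym (seen-intro a n (ℕP.≤-trans t≤i i≤n) at)) not-seen

-- On every window [0, f 0] or [t, f t] (t a witness), seen a is constant.
seen-metastable : ∀ a (f : ℕ → ℕ) → ∃ λ m →
  ∀ i j → m ℕ.≤ i → i ℕ.≤ f m → m ℕ.≤ j → j ℕ.≤ f m → seen a i ≡ seen a j
seen-metastable a f with seen a (f 0) in eq
... | false = 0 , λ i j _ i≤ _ j≤ → trans (seen-below a i≤ eq) (sym (seen-below a j≤ eq))
... | true = let (t , _ , at) = seen-witness a (f 0) eq
             in t , λ i j t≤i _ t≤j _ → trans (seen-intro a i t≤i at) (sym (seen-intro a j t≤j at))

constant-windows⇒metastable : (x : ℕ → ℝ) →
  ((f : ℕ → ℕ) → ∃ λ m → ∀ i j → m ℕ.≤ i → i ℕ.≤ f m → m ℕ.≤ j → j ℕ.≤ f m → x i ≡ x j) →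
  Metastable x
constant-windows⇒metastable x windows ε ε>0 f =
  let (m , const) = windows f
  in m , λ i j mi if mj jf → subst (λ z → distLt z (x j) ε) (sym (const i j mi if mj jf)) (distLt-refl (x j) ε ε>0)

indicator : Bool → ℚ
indicator true = inv 0
indicator false = 0ℚ

X : (ℕ → Bool) → ℕ → ℝ
X a n = constℝ (indicator (seen a n))

X-bounded : ∀ a → Bounded (X a)
X-bounded a = constℝ (inv 0) , λ n k → ≤-trans (-inv≤0 k) (0≤1-∣indicator∣ (seen a n))
  where
  -inv≤0 : ∀ k → 0ℚ - inv k ≤ 0ℚ
  -inv≤0 k = subst (0ℚ - inv k ≤_) (+-identityʳ 0ℚ) (+-monoʳ-≤ 0ℚ (neg-antimono-≤ (inv-nonneg k)))
  0≤1-∣indicator∣ : ∀ b → 0ℚ ≤ inv 0 - ∣ indicator b ∣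
  0≤1-∣indicator∣ true = subst (λ z → 0ℚ ≤ inv 0 - z) (sym (0≤p⇒∣p∣≡p (inv-nonneg 0)))
                               (subst (0ℚ ≤_) (sym (+-inverseʳ (inv 0))) ≤-refl)
  0≤1-∣indicator∣ false = subst (0ℚ ≤_) (sym (+-identityʳ (inv 0))) (inv-nonneg 0)

X-metastable : ∀ a → Metastable (X a)
X-metastable a = constant-windows⇒metastable (X a) λ f →
  let (m , const) = seen-metastable a f
  in m , λ i j mi if mj jf → cong (λ b → constℝ (indicator b)) (const i j mi if mj jf)

one-zero-apart : (y : ℝ) → DistLe (constℝ (inv 0)) y (inv 3) → DistLe (constℝ 0ℚ) y (inv 3) → ⊥
one-zero-apart y near1 near0 = <-irrefl refl (begin-strict
    inv 0                                                        ≡⟨ sym (0≤p⇒∣p∣≡p (inv-nonneg 0)) ⟩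
    ∣ inv 0 ∣                                                    ≡⟨ cong ∣_∣ (sym (+-identityʳ (inv 0))) ⟩
    ∣ inv 0 - 0ℚ ∣                                               ≤⟨ dist-triangle (inv 0) y₁₅ 0ℚ ⟩
    ∣ inv 0 - y₁₅ ∣ + ∣ y₁₅ - 0ℚ ∣                               ≤⟨ +-mono-≤ (near1 15) (subst (_≤ _) (dist-sym 0ℚ y₁₅) (near0 15)) ⟩
    (inv 3 + (inv 15 + inv 15)) + (inv 3 + (inv 15 + inv 15))    ≡⟨ cong (λ z → (inv 3 + z) + (inv 3 + z)) (half 7) ⟩
    (inv 3 + inv 7) + (inv 3 + inv 7)                            ≡⟨ solve 2 (λ a b → (a :+ b) :+ (a :+ b) := (a :+ a) :+ (b :+ b)) refl (inv 3) (inv 7) ⟩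
    (inv 3 + inv 3) + (inv 7 + inv 7)                            ≡⟨ cong₂ _+_ (half 1) (half 3) ⟩
    inv 1 + inv 3                                                <⟨ +-monoʳ-< (inv 1) (inv-strictly-antitone {1} {3} (ℕ.s≤s (ℕ.s≤s ℕ.z≤n))) ⟩
    inv 1 + inv 1                                                ≡⟨ half 0 ⟩
    inv 0                                                        ∎)
  where
  open ≤-Reasoning
  y₁₅ = seq y 15

decide-by-limit : ∀ a y N → (∀ n → N ℕ.≤ n → DistLe (X a n) y (inv 3)) →
                  (∀ n → a n ≡ false) ⊎ (∃ λ n → a n ≡ true)
decide-by-limit a y N near with seen a N in eq
... | true = let (t , _ , at) = seen-witness a N eq in inj₂ (t , at)
... | false = inj₁ never
  where
  never : ∀ n → a n ≡ false
  never n with a n in an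
  ... | false = refl
  ... | true = ⊥-elim (one-zero-apart y near1 near0)
    where
    later = n ℕ.⊔ N
    near1 : DistLe (constℝ (inv 0)) y (inv 3)
    near1 = subst (λ b → DistLe (constℝ (indicator b)) y (inv 3))
                  (seen-intro a later (ℕP.m≤m⊔n n N) an) (near later (ℕP.m≤n⊔m n N))
    near0 : DistLe (constℝ 0ℚ) y (inv 3)
    near0 = subst (λ b → DistLe (constℝ (indicator b)) y (inv 3)) eq (near N ℕP.≤-refl)

converges⇒lpo : BoundedMetastableConverge → LPO
converges⇒lpo converge a =
  let (y , X→y) = converge (X a) (X-bounded a) (X-metastable a)
      (N , near) = X→y (constℝ (inv 3)) (constℝ-inv-positive 3)
  in decide-by-limit a y N λ n N≤n → distLt⇒DistLe (X a n) y (inv 3) (near n N≤n)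

proposition1p2p7 : (LPO → BoundedMetastableConverge) × (BoundedMetastableConverge → LPO)
proposition1p2p7 = lpo⇒converges , converges⇒lpo
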